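{- Work in intuitionistic, predicative mathematics with countable choice ($AC_\omega$) but without the law of excluded middle. Let $L$ be an overt $\sigma$-locale with positivity predicate $Pos$, and let $\approx$ be the congruence on $L$ given by $x\approx y$ iff $\forall z\in L.\,[Pos(x\wedge z)\Leftrightarrow Pos(y\wedge z)]$, with $B(L)=L/\approx$. Then $B(L)$ is the smallest strongly dense $\sigma$-sublocale of $L$: it is strongly dense, and for every congruence $\sim$ on $L$ such that $L/\sim$ is strongly dense in $L$, $x\sim y$ implies $x\approx y$ (i.e. $B(L)$ is a $\sigma$-sublocale of $L/\sim$).
   Context: A $\sigma$-frame is a partial order (whose carrier is a set) with countable joins and finite meets in which binary meets distribute over countable joins; a $\sigma$-locale is a $\sigma$-frame regarded in the opposite category. A set $W$ is countable if there is $\alpha:\mathbb{N}\to W+\{*\}$ with $W\subseteq\alpha[\mathbb{N}]$. A congruence on $L$ is an equivalence relation compatible with finite meets and countable joins; the quotient $L/\sim$ is then a $\sigma$-sublocale of $L$. $L$ is overt if there is a predicate $Pos$ on $L$ such that: (1) if $a\leq b$ and $Pos(a)$ then $Pos(b)$; (2) if $Pos(\bigvee W)$ for a countable $W$, then $Pos(a)$ for some $a\in W$; (3) for every $a$ there is a countable $W\subseteq\{a\}$ with $a=\bigvee W$ and $Pos(b)$ for all $b\in W$. A $\sigma$-sublocale $L/\sim$ is strongly dense in $L$ if $Pos(a)$ implies $Pos(b)$ whenever $a\sim b$. -}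

module Defs where

open import Level using (Level; _⊔_; suc)
open import Data.Nat using (ℕ)
open import Data.Maybe using (Maybe; just; nothing; map)
open import Data.Maybe.Relation.Binary.Pointwise using (Pointwise)
open import Data.Product using (Σ; _×_; _,_; ∃)
open import Relation.Binary.PropositionalEquality using (_≡_)
open import Relation.Binary.Structures using (IsPartialOrder; IsEquivalence)
open import Function.Bundles using (_⇔_)

-- A countable subset W of the carrier is presented, as in the paper, by
-- α : ℕ → Maybe A (i.e. ℕ → W + {*}) with W = { a | ∃ n. α n ≡ just a }.
Countable : ∀ {ℓ} → Set ℓ → Set ℓ
Countable A = ℕ → Maybe A

_∈c_ : ∀ {ℓ} {A : Set ℓ} → A → Countable A → Set ℓ
a ∈c α = ∃ λ n → α n ≡ just a

record SigmaFrame (ℓ : Level) : Set (suc ℓ) where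
  infix 4 _≤_
  infixr 7 _∧_
  field
    Carrier        : Set ℓ
    _≤_            : Carrier → Carrier → Set ℓ
    isPartialOrder : IsPartialOrder _≡_ _≤_
    ⊤              : Carrier
    ⊤-max          : ∀ a → a ≤ ⊤
    _∧_            : Carrier → Carrier → Carrier
    ∧-lb₁          : ∀ a b → a ∧ b ≤ a
    ∧-lb₂          : ∀ a b → a ∧ b ≤ b
    ∧-glb          : ∀ {a b c} → c ≤ a → c ≤ b → c ≤ a ∧ b
    ⋁              : Countable Carrier → Carrier
    ⋁-ub           : ∀ (α : Countable Carrier) {a} → a ∈c α → a ≤ ⋁ α
    ⋁-lub          : ∀ (α : Countable Carrier) {c} → (∀ {a} → a ∈c α → a ≤ c) → ⋁ α ≤ c
    ∧-distrib-⋁    : ∀ a (α : Countable Carrier) → a ∧ ⋁ α ≡ ⋁ (λ n → map (a ∧_) (α n))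

module _ {ℓ : Level} (L : SigmaFrame ℓ) where
  open SigmaFrame L

  record IsOvert (Pos : Carrier → Set ℓ) : Set ℓ where
    field
      Pos-mono   : ∀ {a b} → a ≤ b → Pos a → Pos b
      Pos-⋁      : ∀ (W : Countable Carrier) → Pos (⋁ W) → Σ Carrier λ a → a ∈c W × Pos a
      Pos-cover  : ∀ a → Σ (Countable Carrier) λ W →
                     (∀ {b} → b ∈c W → b ≡ a) × (a ≡ ⋁ W) × (∀ {b} → b ∈c W → Pos b)

  record IsCongruence {r : Level} (_∼_ : Carrier → Carrier → Set r) : Set (ℓ ⊔ r) where
    field
      isEquivalence : IsEquivalence _∼_
      ∧-cong        : ∀ {x y x' y'} → x ∼ y → x' ∼ y' → (x ∧ x') ∼ (y ∧ y')
      ⋁-cong        : ∀ {α β : Countable Carrier} →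
                        (∀ n → Pointwise _∼_ (α n) (β n)) → ⋁ α ∼ ⋁ β

  StronglyDense : {r : Level} → (Carrier → Set ℓ) → (Carrier → Carrier → Set r) → Set (ℓ ⊔ r)
  StronglyDense Pos _∼_ = ∀ {a b} → a ∼ b → Pos a → Pos b

  PosEquiv : (Carrier → Set ℓ) → Carrier → Carrier → Set ℓ
  PosEquiv Pos x y = ∀ z → Pos (x ∧ z) ⇔ Pos (y ∧ z)

-- Strong density of L/∼ says exactly that ∼ preserves Pos; since ∼ is also
-- compatible with meets, x ∼ y then forces Pos (x ∧ z) ⇔ Pos (y ∧ z) for all z,
-- i.e. x ≈ y, so ≈ is the coarsest such congruence once it is one itself.
-- Compatibility of ≈ with meets is associativity and commutativity of ∧;
-- with countable joins it is where overtness enters: Pos (⋁ α ∧ z) is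
-- witnessed by a single Pos (a ∧ z) with a ∈ α, by distributivity and Pos-⋁.
module Submission where

open import Defs
open import Level using (Level)
open import Data.Product using (_×_; _,_; ∃)
open import Data.Maybe using (just; map)
open import Data.Maybe.Relation.Binary.Pointwise as Pointwise using (Pointwise; just-inv)
open import Relation.Binary.PropositionalEquality using (_≡_; refl; sym; trans; subst; subst₂)
open import Relation.Binary.Structures using (IsEquivalence)
open import Relation.Binary.Lattice.Bundles using (BoundedMeetSemilattice)
import Relation.Binary.Lattice.Properties.MeetSemilattice as MeetSemilatticeProperties
import Relation.Binary.Lattice.Properties.BoundedMeetSemilattice as BoundedMeetSemilatticeProperties
open import Function.Bundles using (_⇔_; mk⇔; Equivalence)
import Function.Properties.Equivalence as ⇔

∈c-map : ∀ {a} {A B : Set a} (f : A → B) (α : Countable A) {b} →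
         b ∈c (λ n → map f (α n)) → ∃ λ a → a ∈c α × b ≡ f a
∈c-map f α (n , eq) with α n in αn
∈c-map f α (n , refl) | just a = a , (n , αn) , refl

∈c-pointwise : ∀ {a r} {A : Set a} {R : A → A → Set r} {α β : Countable A} →
               (∀ n → Pointwise R (α n) (β n)) →
               ∀ {a} → a ∈c α → ∃ λ b → b ∈c β × R a b
∈c-pointwise pw (n , αn) with just-inv (subst (λ m → Pointwise _ m _) αn (pw n))
... | b , βn , r = b , (n , βn) , r

boundedMeetSemilattice : ∀ {ℓ} → SigmaFrame ℓ → BoundedMeetSemilattice ℓ ℓ ℓ
boundedMeetSemilattice L = record
  { _≈_ = _≡_
  ; isBoundedMeetSemilattice = record
    { isMeetSemilattice = record
      { isPartialOrder = isPartialOrder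
      ; infimum        = λ x y → ∧-lb₁ x y , ∧-lb₂ x y , λ _ → ∧-glb
      }
    ; maximum = ⊤-max
    }
  }
  where open SigmaFrame L

module _ {ℓ : Level} (L : SigmaFrame ℓ) (Pos : SigmaFrame.Carrier L → Set ℓ) where
  open SigmaFrame L
  open BoundedMeetSemilattice (boundedMeetSemilattice L) using (meetSemilattice) renaming (refl to ≤-refl)
  open MeetSemilatticeProperties meetSemilattice using (∧-comm; ∧-assoc; ∧-monotonic)
  open BoundedMeetSemilatticeProperties (boundedMeetSemilattice L) using (identityʳ)

  private
    _≈_ : Carrier → Carrier → Set ℓ
    _≈_ = PosEquiv L Pos

    Pos-subst : ∀ {a b} → a ≡ b → Pos a ⇔ Pos b
    Pos-subst refl = ⇔.refl

  ∧-distribʳ-⋁ : ∀ α z → ⋁ α ∧ z ≡ ⋁ (λ n → map (z ∧_) (α n))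
  ∧-distribʳ-⋁ α z = trans (∧-comm (⋁ α) z) (∧-distrib-⋁ z α)

  PosEquiv-isEquivalence : IsEquivalence _≈_
  PosEquiv-isEquivalence = record
    { refl  = λ _ → ⇔.refl
    ; sym   = λ e z → ⇔.sym (e z)
    ; trans = λ e f z → ⇔.trans (e z) (f z)
    }

  open IsEquivalence PosEquiv-isEquivalence using () renaming (sym to ≈-sym; trans to ≈-trans)

  PosEquiv-∧-congʳ : ∀ {x y} → x ≈ y → ∀ w → (x ∧ w) ≈ (y ∧ w)
  PosEquiv-∧-congʳ {x} {y} e w z =
    ⇔.trans (Pos-subst (∧-assoc x w z))
      (⇔.trans (e (w ∧ z)) (Pos-subst (sym (∧-assoc y w z))))

  PosEquiv-∧-cong : ∀ {x y x' y'} → x ≈ y → x' ≈ y' → (x ∧ x') ≈ (y ∧ y')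
  PosEquiv-∧-cong {x} {y} {x'} {y'} e e' =
    ≈-trans (PosEquiv-∧-congʳ e x')
      (subst₂ _≈_ (∧-comm x' y) (∧-comm y' y) (PosEquiv-∧-congʳ e' y))

  PosEquiv-stronglyDense : StronglyDense L Pos _≈_
  PosEquiv-stronglyDense {x} {y} e =
    Equivalence.to (⇔.trans (Pos-subst (sym (identityʳ x))) (⇔.trans (e ⊤) (Pos-subst (identityʳ y))))

  stronglyDense⇒⊆PosEquiv : ∀ {_∼_ : Carrier → Carrier → Set ℓ} →
                            IsCongruence L _∼_ → StronglyDense L Pos _∼_ →
                            ∀ {x y} → x ∼ y → x ≈ y
  stronglyDense⇒⊆PosEquiv {_∼_} c dense x∼y z =
    mk⇔ (dense (∧-cong x∼y ∼-refl)) (dense (∧-cong (∼-sym x∼y) ∼-refl))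
    where
    open IsCongruence c using (∧-cong; isEquivalence)
    open IsEquivalence isEquivalence renaming (refl to ∼-refl; sym to ∼-sym)

  module _ (overt : IsOvert L Pos) where
    open IsOvert overt

    Pos-⋁∧⇒∈c : ∀ α z → Pos (⋁ α ∧ z) → ∃ λ a → a ∈c α × Pos (a ∧ z)
    Pos-⋁∧⇒∈c α z p with Pos-⋁ _ (subst Pos (∧-distribʳ-⋁ α z) p)
    ... | b , b∈ , pb with ∈c-map (z ∧_) α b∈
    ... | a , a∈ , refl = a , a∈ , subst Pos (∧-comm z a) pb

    ∈c⇒Pos-⋁∧ : ∀ α z {a} → a ∈c α → Pos (a ∧ z) → Pos (⋁ α ∧ z)
    ∈c⇒Pos-⋁∧ α z a∈ = Pos-mono (∧-monotonic (⋁-ub α a∈) ≤-refl)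

    PosEquiv-⋁-cong⇒ : ∀ {α β} → (∀ n → Pointwise _≈_ (α n) (β n)) →
                       ∀ z → Pos (⋁ α ∧ z) → Pos (⋁ β ∧ z)
    PosEquiv-⋁-cong⇒ {α} {β} pw z p with Pos-⋁∧⇒∈c α z p
    ... | a , a∈ , pa with ∈c-pointwise pw a∈
    ... | b , b∈ , a≈b = ∈c⇒Pos-⋁∧ β z b∈ (Equivalence.to (a≈b z) pa)

    PosEquiv-isCongruence : IsCongruence L _≈_
    PosEquiv-isCongruence = record
      { isEquivalence = PosEquiv-isEquivalence
      ; ∧-cong        = PosEquiv-∧-cong
      ; ⋁-cong        = λ pw z → mk⇔ (PosEquiv-⋁-cong⇒ pw z)
                                         (PosEquiv-⋁-cong⇒ (λ n → Pointwise.sym ≈-sym (pw n)) z)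
      }

mainTheorem9 : ∀ {ℓ : Level} (L : SigmaFrame ℓ) (Pos : SigmaFrame.Carrier L → Set ℓ) →
    IsOvert L Pos →
    IsCongruence L (PosEquiv L Pos)
    × StronglyDense L Pos (PosEquiv L Pos)
    × (∀ (_∼_ : SigmaFrame.Carrier L → SigmaFrame.Carrier L → Set ℓ) →
    IsCongruence L _∼_ → StronglyDense L Pos _∼_ →
    ∀ x y → x ∼ y → PosEquiv L Pos x y)
mainTheorem9 L Pos overt =
    PosEquiv-isCongruence L Pos overt
  , PosEquiv-stronglyDense L Pos
  , λ _ c dense x y → stronglyDense⇒⊆PosEquiv L Pos c dense
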